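{- Let $\hat D,\hat N,\hat M,\hat w$ be non-negative integers such that (i) $\hat N\geq 3\hat w$; (ii) $\hat D^2\geq 4\hat N\hat w$; and (iii) $\hat M\hat D\geq 2\hat N\hat w$. Let $S_1,\ldots,S_{\hat M}$ be subsets of $\{1,\ldots,\hat N\}$ with $|S_i|\geq\hat D$ for each $1\le i\le\hat M$. Then there are $\hat w$ indices $1\leq i_1<i_2<\cdots<i_{\hat w}\leq\hat M$ such that $|S_{i_j}\cap S_{i_{j+1}}|\geq\hat w$ for all $1\leq j<\hat w$. -}

module Defs where

open import Data.Nat using (ℕ; suc; _<_; _≥_)
open import Data.Nat.Properties using (<-trans; n<1+n)
open import Data.Fin using (Fin; fromℕ<)
import Data.Fin as F
open import Data.Fin.Subset using (Subset; _∩_; ∣_∣)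

-- A selection of w indices i₁ < … < i_w from {1..M} (0-based: Fin M),
-- given as a strictly increasing map Fin w → Fin M.
StrictlyIncreasing : ∀ {w M} → (Fin w → Fin M) → Set
StrictlyIncreasing {w} idx = ∀ (j k : Fin w) → j F.< k → idx j F.< idx k

ConsecutiveOverlap : ∀ {N M w} → (Fin M → Subset N) → (Fin w → Fin M) → ℕ → Set
ConsecutiveOverlap {N} {M} {w} S idx t =
  ∀ (j : ℕ) (p : suc j < w) →
    ∣ S (idx (fromℕ< (<-trans (n<1+n j) p))) ∩ S (idx (fromℕ< p)) ∣ ≥ t

{-# OPTIONS --safe #-}
module Submission where

-- Join i < j when S i and S j share at least w points, and let t = w − 1. Without an
-- increasing path through w indices, grading each index by the length of the longest
-- increasing path it starts splits the M indices into t classes, none containing a joined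
-- pair. Choose q with q D < 2N ≤ (q + 1) D; by (iii), M > t q, so some class holds q + 1
-- sets pairwise sharing at most t points. Bonferroni's inequality
-- (q + 1) D ≤ N + t·C(q + 1, 2) then gives D ≤ t q, hence D² ≤ t q D < 2N w ≤ 4N w,
-- contradicting (ii).

open import Defs
open import Data.Nat using (ℕ; zero; suc; _+_; _*_; _≤_; _<_; _≥_; z≤n; s≤s; z<s; _≟_; _≤?_; _<?_; NonZero)
open import Data.Nat.Properties
open import Data.Nat.DivMod using (_/_; _%_; m/n*n≤m; m%n<n; m≡m%n+[m/n]*n)
open import Data.Nat.Combinatorics using (_C_; nC1≡n; nCk+nC[k+1]≡[n+1]C[k+1])
open import Data.Nat.ListAction using (sum)
open import Data.Nat.Tactic.RingSolver using (solve-∀)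
open import Data.Bool using (true; false)
open import Data.Vec using ([]; _∷_)
open import Data.Fin using (Fin; zero; suc; fromℕ<)
import Data.Fin as F
open import Data.Fin.Subset using (Subset; _∩_; _∪_; ∣_∣; ⋃)
open import Data.Fin.Subset.Properties using (∩-distribˡ-∪; ∩-zeroʳ; ∣⊥∣≡0; ∣p∣≤n)
open import Data.List using (List; []; _∷_; length; map; filter; take; allFin)
open import Data.List.Properties using (length-map; length-take; length-tabulate)
open import Data.List.Relation.Unary.All as All using (All; []; _∷_)
import Data.List.Relation.Unary.All.Properties as All
open import Data.List.Relation.Unary.AllPairs as AllPairs using (AllPairs; []; _∷_)
import Data.List.Relation.Unary.AllPairs.Properties as AllPairs
import Data.List.Relation.Binary.Sublist.Propositional.Properties as Sublist
open import Data.Product using (Σ; ∃; _×_; _,_; map₂)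
open import Data.Sum using (_⊎_; inj₁; inj₂)
import Data.Sum as Sum
open import Data.Empty using (⊥-elim)
open import Function using (id)
open import Relation.Nullary using (¬_; Dec; yes; no)
open import Relation.Unary using (Pred; Decidable)
open import Relation.Unary.Properties using (∁?)
open import Relation.Binary.PropositionalEquality using (_≡_; refl; sym; trans; cong; subst; module ≡-Reasoning)

∣p∣+∣q∣≡∣p∪q∣+∣p∩q∣ : ∀ {n} (p q : Subset n) → ∣ p ∣ + ∣ q ∣ ≡ ∣ p ∪ q ∣ + ∣ p ∩ q ∣
∣p∣+∣q∣≡∣p∪q∣+∣p∩q∣ []          []          = refl
∣p∣+∣q∣≡∣p∪q∣+∣p∩q∣ (true ∷ p)  (true ∷ q)  =
  cong suc (trans (+-suc _ _) (trans (cong suc (∣p∣+∣q∣≡∣p∪q∣+∣p∩q∣ p q)) (sym (+-suc _ _))))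
∣p∣+∣q∣≡∣p∪q∣+∣p∩q∣ (true ∷ p)  (false ∷ q) = cong suc (∣p∣+∣q∣≡∣p∪q∣+∣p∩q∣ p q)
∣p∣+∣q∣≡∣p∪q∣+∣p∩q∣ (false ∷ p) (true ∷ q)  = trans (+-suc _ _) (cong suc (∣p∣+∣q∣≡∣p∪q∣+∣p∩q∣ p q))
∣p∣+∣q∣≡∣p∪q∣+∣p∩q∣ (false ∷ p) (false ∷ q) = ∣p∣+∣q∣≡∣p∪q∣+∣p∩q∣ p q

∣p∪q∣≤∣p∣+∣q∣ : ∀ {n} (p q : Subset n) → ∣ p ∪ q ∣ ≤ ∣ p ∣ + ∣ q ∣
∣p∪q∣≤∣p∣+∣q∣ p q = ≤-trans (m≤m+n _ _) (≤-reflexive (sym (∣p∣+∣q∣≡∣p∪q∣+∣p∩q∣ p q)))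

module _ {n : ℕ} (t : ℕ) where

  ∣p∩⋃qs∣≤∣qs∣*t : (p : Subset n) (qs : List (Subset n)) → All (λ q → ∣ p ∩ q ∣ ≤ t) qs →
                   ∣ p ∩ ⋃ qs ∣ ≤ length qs * t
  ∣p∩⋃qs∣≤∣qs∣*t p []       []         = ≤-reflexive (trans (cong ∣_∣ (∩-zeroʳ p)) (∣⊥∣≡0 n))
  ∣p∩⋃qs∣≤∣qs∣*t p (q ∷ qs) (pq≤t ∷ h) = begin
    ∣ p ∩ (q ∪ ⋃ qs) ∣        ≡⟨ cong ∣_∣ (∩-distribˡ-∪ p q (⋃ qs)) ⟩
    ∣ (p ∩ q) ∪ (p ∩ ⋃ qs) ∣  ≤⟨ ∣p∪q∣≤∣p∣+∣q∣ (p ∩ q) (p ∩ ⋃ qs) ⟩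
    ∣ p ∩ q ∣ + ∣ p ∩ ⋃ qs ∣  ≤⟨ +-mono-≤ pq≤t (∣p∩⋃qs∣≤∣qs∣*t p qs h) ⟩
    t + length qs * t         ∎
    where open ≤-Reasoning

  bonferroni : (ps : List (Subset n)) → AllPairs (λ p q → ∣ p ∩ q ∣ ≤ t) ps →
               sum (map ∣_∣ ps) ≤ ∣ ⋃ ps ∣ + t * (length ps C 2)
  bonferroni []       []       = z≤n
  bonferroni (p ∷ ps) (h ∷ hs) = begin
    ∣ p ∣ + sum (map ∣_∣ ps)             ≤⟨ +-monoʳ-≤ ∣ p ∣ (bonferroni ps hs) ⟩
    ∣ p ∣ + (∣ U ∣ + t * (r C 2))        ≡⟨ sym (+-assoc ∣ p ∣ ∣ U ∣ _) ⟩
    ∣ p ∣ + ∣ U ∣ + t * (r C 2)          ≡⟨ cong (_+ t * (r C 2)) (∣p∣+∣q∣≡∣p∪q∣+∣p∩q∣ p U) ⟩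
    ∣ p ∪ U ∣ + ∣ p ∩ U ∣ + t * (r C 2)  ≤⟨ +-monoˡ-≤ _ (+-monoʳ-≤ ∣ p ∪ U ∣ (∣p∩⋃qs∣≤∣qs∣*t p ps h)) ⟩
    ∣ p ∪ U ∣ + r * t + t * (r C 2)      ≡⟨ ring ∣ p ∪ U ∣ r t (r C 2) ⟩
    ∣ p ∪ U ∣ + t * (r + r C 2)          ≡⟨ cong (λ c → ∣ p ∪ U ∣ + t * (c + r C 2)) (sym (nC1≡n r)) ⟩
    ∣ p ∪ U ∣ + t * (r C 1 + r C 2)      ≡⟨ cong (λ c → ∣ p ∪ U ∣ + t * c) (nCk+nC[k+1]≡[n+1]C[k+1] r 1) ⟩
    ∣ p ∪ U ∣ + t * (suc r C 2)          ∎
    where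
    open ≤-Reasoning
    U = ⋃ ps
    r = length ps
    ring : ∀ u r t c → u + r * t + t * c ≡ u + t * (r + c)
    ring = solve-∀

length*m≤sum : ∀ {a} {A : Set a} {m} (f : A → ℕ) (xs : List A) → All (λ x → m ≤ f x) xs →
               length xs * m ≤ sum (map f xs)
length*m≤sum f []       []         = z≤n
length*m≤sum f (x ∷ xs) (m≤fx ∷ h) = +-mono-≤ m≤fx (length*m≤sum f xs h)

2*[1+n]C2≡[1+n]*n : ∀ n → 2 * (suc n C 2) ≡ suc n * n
2*[1+n]C2≡[1+n]*n zero    = refl
2*[1+n]C2≡[1+n]*n (suc n) = begin
  2 * (suc (suc n) C 2)        ≡⟨ cong (2 *_) (sym (nCk+nC[k+1]≡[n+1]C[k+1] (suc n) 1)) ⟩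
  2 * (suc n C 1 + suc n C 2)  ≡⟨ cong (λ c → 2 * (c + suc n C 2)) (nC1≡n (suc n)) ⟩
  2 * (suc n + suc n C 2)      ≡⟨ *-distribˡ-+ 2 (suc n) _ ⟩
  2 * suc n + 2 * (suc n C 2)  ≡⟨ cong (2 * suc n +_) (2*[1+n]C2≡[1+n]*n n) ⟩
  2 * suc n + suc n * n        ≡⟨ ring n ⟩
  suc (suc n) * suc n          ∎
  where
  open ≡-Reasoning
  ring : ∀ n → 2 * suc n + suc n * n ≡ suc (suc n) * suc n
  ring = solve-∀

between-multiples : ∀ n D .{{_ : NonZero n}} .{{_ : NonZero D}} → ∃ λ q → q * D < n × n ≤ suc q * D
between-multiples (suc m) D = m / D , s≤s (m/n*n≤m m D) , (begin
  suc m                    ≡⟨ cong suc (m≡m%n+[m/n]*n m D) ⟩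
  suc (m % D + m / D * D)  ≤⟨ +-monoˡ-≤ (m / D * D) (m%n<n m D) ⟩
  D + m / D * D            ∎)
  where open ≤-Reasoning

m<n⇒t*m<n*[1+t] : ∀ {m n} t → m < n → t * m < n * suc t
m<n⇒t*m<n*[1+t] {m} {n} t m<n = begin-strict
  t * m      ≤⟨ *-monoʳ-≤ t (<⇒≤ m<n) ⟩
  t * n      ≡⟨ *-comm t n ⟩
  n * t      <⟨ m<n+m (n * t) (≤-<-trans z≤n m<n) ⟩
  n + n * t  ≡⟨ sym (*-suc n t) ⟩
  n * suc t  ∎
  where open ≤-Reasoning

D≤t*q : ∀ {N} t q D → 2 * N ≤ suc q * D → suc q * D ≤ N + t * (suc q C 2) → D ≤ t * q
D≤t*q {N} t q D 2N≤[1+q]D [1+q]D≤ = *-cancelˡ-≤ (suc q) (+-cancelˡ-≤ (suc q * D) _ _ (begin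
  suc q * D + suc q * D          ≡⟨ ring₁ (suc q * D) ⟩
  2 * (suc q * D)                ≤⟨ *-monoʳ-≤ 2 [1+q]D≤ ⟩
  2 * (N + t * (suc q C 2))      ≡⟨ ring₂ N t (suc q C 2) ⟩
  2 * N + t * (2 * (suc q C 2))  ≡⟨ cong (λ c → 2 * N + t * c) (2*[1+n]C2≡[1+n]*n q) ⟩
  2 * N + t * (suc q * q)        ≤⟨ +-mono-≤ 2N≤[1+q]D (≤-reflexive (ring₃ t (suc q) q)) ⟩
  suc q * D + suc q * (t * q)    ∎))
  where
  open ≤-Reasoning
  ring₁ : ∀ x → x + x ≡ 2 * x
  ring₁ = solve-∀
  ring₂ : ∀ N t c → 2 * (N + t * c) ≡ 2 * N + t * (2 * c)
  ring₂ = solve-∀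
  ring₃ : ∀ t r q → t * (r * q) ≡ r * (t * q)
  ring₃ = solve-∀

t*q<M : ∀ {t q D n} M → q * D < n → n * suc t ≤ M * D → t * q < M
t*q<M {t} {q} {D} {n} M qD<n n[1+t]≤MD = *-cancelʳ-< D (t * q) M (begin-strict
  t * q * D    ≡⟨ *-assoc t q D ⟩
  t * (q * D)  <⟨ m<n⇒t*m<n*[1+t] t qD<n ⟩
  n * suc t    ≤⟨ n[1+t]≤MD ⟩
  M * D        ∎)
  where open ≤-Reasoning

D*D<4*N*[1+t] : ∀ {N} t q D → D ≤ t * q → q * D < 2 * N → D * D < 4 * N * suc t
D*D<4*N*[1+t] {N} t q D D≤tq qD<2N = begin-strict
  D * D          ≤⟨ *-monoˡ-≤ D D≤tq ⟩
  t * q * D      ≡⟨ *-assoc t q D ⟩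
  t * (q * D)    <⟨ m<n⇒t*m<n*[1+t] t qD<2N ⟩
  2 * N * suc t  ≤⟨ *-monoˡ-≤ (suc t) (*-monoˡ-≤ N {2} {4} (s≤s (s≤s z≤n))) ⟩
  4 * N * suc t  ∎
  where open ≤-Reasoning

sparse-family-bound : ∀ {N} t q D (ps : List (Subset N)) → length ps ≡ suc q →
                      All (λ p → D ≤ ∣ p ∣) ps → AllPairs (λ p p′ → ∣ p ∩ p′ ∣ ≤ t) ps →
                      suc q * D ≤ N + t * (suc q C 2)
sparse-family-bound {N} t q D ps ∣ps∣≡1+q large sparse = begin
  suc q * D                          ≡⟨ cong (_* D) (sym ∣ps∣≡1+q) ⟩
  length ps * D                      ≤⟨ length*m≤sum ∣_∣ ps large ⟩
  sum (map ∣_∣ ps)                   ≤⟨ bonferroni t ps sparse ⟩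
  ∣ ⋃ ps ∣ + t * (length ps C 2)     ≤⟨ +-mono-≤ (∣p∣≤n (⋃ ps)) (≤-reflexive (cong (λ r → t * (r C 2)) ∣ps∣≡1+q)) ⟩
  N + t * (suc q C 2)                ∎
  where open ≤-Reasoning

length-filter+filter-∁ : ∀ {a p} {A : Set a} {P : Pred A p} (P? : Decidable P) xs →
                         length (filter P? xs) + length (filter (∁? P?) xs) ≡ length xs
length-filter+filter-∁ P? []       = refl
length-filter+filter-∁ P? (x ∷ xs) with P? x
... | yes _ = cong suc (length-filter+filter-∁ P? xs)
... | no  _ = trans (+-suc _ _) (cong suc (length-filter+filter-∁ P? xs))

pigeonhole : ∀ {a} {A : Set a} (f : A → ℕ) k q (xs : List A) → All (λ x → f x < k) xs → k * q < length xs →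
             ∃ λ d → q < length (filter (λ x → f x ≟ d) xs)
pigeonhole f zero    q (_ ∷ _) (() ∷ _) _
pigeonhole f (suc k) q xs f<1+k q+kq<∣xs∣ with q <? length (filter (λ x → f x ≟ k) xs)
... | yes q<∣cls∣ = k , q<∣cls∣
... | no  q≮∣cls∣ = map₂ (λ q<∣·∣ → <-≤-trans q<∣·∣ ∣cls-in-rest∣≤∣cls∣) (pigeonhole f k q rest f<k kq<∣rest∣)
  where
  rest = filter (∁? (λ x → f x ≟ k)) xs
  ∣cls-in-rest∣≤∣cls∣ : ∀ {d} → length (filter (λ x → f x ≟ d) rest) ≤ length (filter (λ x → f x ≟ d) xs)
  ∣cls-in-rest∣≤∣cls∣ = Sublist.length-mono-≤ (Sublist.filter⁺ _ _ (λ { refl → id }) (Sublist.filter-⊆ _ xs))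
  f<k : All (λ x → f x < k) rest
  f<k = All.zipWith (λ (fx<1+k , fx≢k) → ≤∧≢⇒< (≤-pred fx<1+k) fx≢k) (All.filter⁺ _ f<1+k , All.all-filter _ xs)
  kq<∣rest∣ : k * q < length rest
  kq<∣rest∣ = +-cancelˡ-< q (k * q) (length rest) (<-≤-trans q+kq<∣xs∣ (≤-trans
    (≤-reflexive (sym (length-filter+filter-∁ _ xs))) (+-monoˡ-≤ _ (≮⇒≥ q≮∣cls∣))))

AllPairs-restrict : ∀ {a p r} {A : Set a} {P : Pred A p} {R : A → A → Set r} {xs} →
                    All P xs → AllPairs (λ x y → P x → P y → R x y) xs → AllPairs R xs
AllPairs-restrict []         []         = []
AllPairs-restrict (px ∷ pxs) (rx ∷ rxs) =
  All.zipWith (λ (r , py) → r px py) (rx , pxs) ∷ AllPairs-restrict pxs rxs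

module _ {M : ℕ} (E : Fin M → Fin M → Set) where

  data Chain : ℕ → Fin M → Set where
    [_]  : ∀ v → Chain 1 v
    step : ∀ {n u v} → u F.< v → E u v → Chain (suc n) v → Chain (suc (suc n)) u

  vertex : ∀ {n v} → Chain n v → Fin n → Fin M
  vertex [ v ]                _       = v
  vertex (step {u = u} _ _ _) zero    = u
  vertex (step _ _ c)         (suc j) = vertex c j

  vertex-zero : ∀ {n v} (c : Chain (suc n) v) → vertex c zero ≡ v
  vertex-zero [ v ]        = refl
  vertex-zero (step _ _ _) = refl

  start≤vertex : ∀ {n v} (c : Chain n v) j → v F.≤ vertex c j
  start≤vertex [ v ]          _       = ≤-refl
  start≤vertex (step _ _ _)   zero    = ≤-refl
  start≤vertex (step u<v _ c) (suc j) = <⇒≤ (<-≤-trans u<v (start≤vertex c j))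

  vertex-increasing : ∀ {n v} (c : Chain n v) → StrictlyIncreasing (vertex c)
  vertex-increasing (step u<v _ c) zero    (suc k) _         = <-≤-trans u<v (start≤vertex c k)
  vertex-increasing (step _ _ c)   (suc j) (suc k) (s≤s j<k) = vertex-increasing c j k j<k

  vertex-linked : ∀ {n v} (c : Chain n v) (j : ℕ) (p : suc j < n) →
                  E (vertex c (fromℕ< (<-trans (n<1+n j) p))) (vertex c (fromℕ< p))
  vertex-linked [ _ ]                _       (s≤s ())
  vertex-linked (step {u = u} _ e c) zero    _       = subst (E u) (sym (vertex-zero c)) e
  vertex-linked (step _ _ c)         (suc j) (s≤s p) = vertex-linked c j p

record Grading {M : ℕ} (E : Fin M → Fin M → Set) (k : ℕ) : Set where
  field
    height            : Fin M → ℕ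
    height<k          : ∀ v → height v < k
    chain-from        : ∀ v → Chain E (suc (height v)) v
    height-decreasing : ∀ {u v} → u F.< v → E u v → height v < height u

strict-sup : ∀ {n p} {P : Pred (Fin n) p} → Decidable P → (h : Fin n → ℕ) →
             ∃ λ s → (∀ j → P j → h j < s) × (s ≡ 0 ⊎ ∃ λ j → P j × s ≡ suc (h j))
strict-sup {zero}  P? h = 0 , (λ ()) , inj₁ refl
strict-sup {suc n} {P = P} P? h with strict-sup (λ j → P? (suc j)) (λ j → h (suc j))
... | s , bound , attained with P? zero
...   | no ¬P0 = s , bound′ , Sum.map₂ (λ (j , Pj , eq) → suc j , Pj , eq) attained
  where bound′ : ∀ j → P j → h j < s
        bound′ zero    P0  = ⊥-elim (¬P0 P0)
        bound′ (suc j) Psj = bound j Psj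
...   | yes P0 with s ≤? h zero
...     | yes s≤h0 = suc (h zero) , bound′ , inj₂ (zero , P0 , refl)
  where bound′ : ∀ j → P j → h j < suc (h zero)
        bound′ zero    _   = ≤-refl
        bound′ (suc j) Psj = m≤n⇒m≤1+n (≤-trans (bound j Psj) s≤h0)
...     | no s≰h0 = s , bound′ , Sum.map₂ (λ (j , Pj , eq) → suc j , Pj , eq) attained
  where bound′ : ∀ j → P j → h j < s
        bound′ zero    _   = ≰⇒> s≰h0
        bound′ (suc j) Psj = bound j Psj

module _ {M : ℕ} {E : Fin (suc M) → Fin (suc M) → Set} where

  Eˢ : Fin M → Fin M → Set
  Eˢ i j = E (suc i) (suc j)

  chain-suc : ∀ {n v} → Chain Eˢ n v → Chain E n (suc v)
  chain-suc [ v ]          = [ suc v ]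
  chain-suc (step u<v e c) = step (s≤s u<v) e (chain-suc c)

  module _ {k : ℕ} (g : Grading Eˢ k) where
    open Grading g

    chain-from-zero : ∀ {s} → s ≡ 0 ⊎ (∃ λ j → E zero (suc j) × s ≡ suc (height j)) →
                      s ≤ k × Chain E (suc s) zero
    chain-from-zero (inj₁ refl)           = z≤n , [ zero ]
    chain-from-zero (inj₂ (j , e , refl)) = height<k j , step z<s e (chain-suc (chain-from j))

    grading-suc : ∀ {s} → s < k → Chain E (suc s) zero → (∀ j → E zero (suc j) → height j < s) →
                  Grading E k
    grading-suc {s} s<k c bound = record
      { height            = height′
      ; height<k          = height′<k
      ; chain-from        = chain-from′
      ; height-decreasing = decreasing
      }
      where
      height′ : Fin (suc M) → ℕ
      height′ zero    = s
      height′ (suc v) = height v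
      height′<k : ∀ v → height′ v < k
      height′<k zero    = s<k
      height′<k (suc v) = height<k v
      chain-from′ : ∀ v → Chain E (suc (height′ v)) v
      chain-from′ zero    = c
      chain-from′ (suc v) = chain-suc (chain-from v)
      decreasing : ∀ {u v} → u F.< v → E u v → height′ v < height′ u
      decreasing {zero}  {suc v} _         e = bound v e
      decreasing {suc u} {suc v} (s≤s u<v) e = height-decreasing u<v e

-- Vertices are graded from the last one down by the length of the longest chain they start.
chain-or-grading : ∀ {M} (E : Fin M → Fin M → Set) → (∀ u v → Dec (E u v)) → ∀ k →
                   (∃ λ v → Chain E (suc k) v) ⊎ Grading E k
chain-or-grading {zero}  E E? k = inj₂ record
  { height = λ () ; height<k = λ () ; chain-from = λ () ; height-decreasing = λ { {()} } }
chain-or-grading {suc M} E E? k with chain-or-grading (Eˢ {E = E}) (λ i j → E? (suc i) (suc j)) k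
... | inj₁ (v , c) = inj₁ (suc v , chain-suc c)
... | inj₂ g with strict-sup (λ j → E? zero (suc j)) (Grading.height g)
...   | s , bound , attained with chain-from-zero g attained | s <? k
...     | s≤k , c | yes s<k = inj₂ (grading-suc g s<k c bound)
...     | s≤k , c | no  s≮k = inj₁ (zero , subst (λ n → Chain E (suc n) zero) (≤-antisym s≤k (≮⇒≥ s≮k)) c)

module _ {M : ℕ} {E : Fin M → Fin M → Set} {k : ℕ} (g : Grading E k) where
  open Grading g

  independent-list : ∀ q → k * q < M → ∃ λ vs → length vs ≡ suc q × AllPairs (λ u v → ¬ E u v) vs
  independent-list q kq<M with pigeonhole height k q (allFin M) (All.tabulate⁺ height<k)
                                 (subst (k * q <_) (sym (length-tabulate id)) kq<M)
  ... | d , q<∣cls∣ = take (suc q) cls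
                    , trans (length-take (suc q) cls) (m≤n⇒m⊓n≡m q<∣cls∣)
                    , AllPairs.take⁺ (suc q) independent
    where
    cls = filter (λ v → height v ≟ d) (allFin M)
    same-height⇒¬E : ∀ {u v} → u F.< v → height u ≡ d → height v ≡ d → ¬ E u v
    same-height⇒¬E u<v hu hv e = <-irrefl (trans hv (sym hu)) (height-decreasing u<v e)
    independent : AllPairs (λ u v → ¬ E u v) cls
    independent = AllPairs-restrict (All.all-filter _ (allFin M))
                    (AllPairs.filter⁺ _ (AllPairs.tabulate⁺-< same-height⇒¬E))

Overlap : ∀ {N M} → (Fin M → Subset N) → ℕ → Fin M → Fin M → Set
Overlap S w u v = w ≤ ∣ S u ∩ S v ∣

theorem4p20 : (D N M w : ℕ) → N ≥ 3 * w → D * D ≥ 4 * N * w → M * D ≥ 2 * N * w →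
    (S : Fin M → Subset N) → (∀ i → ∣ S i ∣ ≥ D) →
    Σ (Fin w → Fin M) (λ idx → StrictlyIncreasing idx × ConsecutiveOverlap S idx w)
theorem4p20 D N M zero _ _ _ _ _ = (λ ()) , (λ ()) , (λ _ ())
-- Hypothesis (i) is needed only to rule out N = 0.
theorem4p20 D zero M (suc t) () _ _ _ _
theorem4p20 zero (suc n) M (suc t) _ () _ _ _
theorem4p20 D@(suc _) N@(suc _) M (suc t) _ 4Nw≤DD 2Nw≤MD S ∣S∣≥D
  with chain-or-grading (Overlap S (suc t)) (λ u v → suc t ≤? ∣ S u ∩ S v ∣) t
... | inj₁ (_ , c) = vertex _ c , vertex-increasing _ c , vertex-linked _ c
... | inj₂ g with between-multiples (2 * N) D
...   | q , qD<2N , 2N≤[1+q]D with independent-list g q (t*q<M M qD<2N 2Nw≤MD)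
...     | vs , ∣vs∣≡1+q , independent = ⊥-elim (<⇒≱ (D*D<4*N*[1+t] {N} t q D D≤tq qD<2N) 4Nw≤DD)
  where
  sparse : AllPairs (λ p p′ → ∣ p ∩ p′ ∣ ≤ t) (map S vs)
  sparse = AllPairs.map⁺ (AllPairs.map (λ ¬overlap → ≤-pred (≰⇒> ¬overlap)) independent)
  D≤tq : D ≤ t * q
  D≤tq = D≤t*q t q D 2N≤[1+q]D (sparse-family-bound t q D (map S vs)
           (trans (length-map S vs) ∣vs∣≡1+q) (All.map⁺ (All.universal ∣S∣≥D vs)) sparse)
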